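{- For every integer $n\ge 12$ we have $f(n,2)=2n$.
   Context: An antichain in $2^{[n]}$ (where $[n]=\{1,\dots,n\}$) is a family of subsets of $[n]$ none of which is contained in another. There is an unknown antichain $\mathcal{S}\subseteq 2^{[n]}$ with exactly $k$ members. A query is a set $Q\subseteq[n]$, answered YES if $Q\supseteq S$ for some $S\in\mathcal{S}$ and NO otherwise. $f(n,k)$ is the smallest $q$ such that some adaptive strategy (queries may depend on previous answers) determines every $k$-member antichain $\mathcal{S}$ uniquely using at most $q$ queries in the worst case. -}

module Defs where

open import Data.Nat using (ℕ; _≤_)
open import Data.Bool using (Bool; true; false; if_then_else_)
open import Data.List using (List; []; _∷_; length)
open import Data.List.Relation.Unary.Any using (any?)
open import Data.List.Relation.Unary.AllPairs using (AllPairs)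
open import Data.List.Membership.Propositional using (_∈_)
open import Data.Fin.Subset using (Subset; _⊆_)
open import Data.Fin.Subset.Properties using (_⊆?_)
open import Data.Product using (_×_; Σ)
open import Relation.Nullary using (¬_; does)
open import Relation.Binary.PropositionalEquality using (_≡_; _≢_)
open import Function.Bundles using (_⇔_)

Family : ℕ → Set
Family n = List (Subset n)

IsAntichain : {n : ℕ} → ℕ → Family n → Set
IsAntichain k 𝒮 =
  (length 𝒮 ≡ k) × AllPairs (λ A B → A ≢ B × (¬ (A ⊆ B) × ¬ (B ⊆ A))) 𝒮

SameFamily : {n : ℕ} → Family n → Family n → Set
SameFamily 𝒮 𝒯 = ∀ S → (S ∈ 𝒮) ⇔ (S ∈ 𝒯)

answer : {n : ℕ} → Family n → Subset n → Bool
answer 𝒮 Q = does (any? (λ S → S ⊆? Q) 𝒮)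

-- Adaptive strategies as binary decision trees: a node asks a query Q and
-- continues in the first subtree on YES and in the second on NO.
data Strategy (n : ℕ) : Set where
  stop : Strategy n
  ask  : Subset n → Strategy n → Strategy n → Strategy n

run : {n : ℕ} → Strategy n → Family n → List Bool
run stop 𝒮 = []
run (ask Q y m) 𝒮 =
  if answer 𝒮 Q then true ∷ run y 𝒮 else false ∷ run m 𝒮

Determines : {n : ℕ} → ℕ → Strategy n → Set
Determines k T = ∀ 𝒮 𝒯 → IsAntichain k 𝒮 → IsAntichain k 𝒯 →
  run T 𝒮 ≡ run T 𝒯 → SameFamily 𝒮 𝒯

WorstCaseAtMost : {n : ℕ} → ℕ → Strategy n → ℕ → Set
WorstCaseAtMost k T q = ∀ 𝒮 → IsAntichain k 𝒮 → length (run T 𝒮) ≤ q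

Achievable : ℕ → ℕ → ℕ → Set
Achievable n k q = Σ (Strategy n) λ T → Determines k T × WorstCaseAtMost k T q

IsF : ℕ → ℕ → ℕ → Set
IsF n k m = Achievable n k m × (∀ q → Achievable n k q → m ≤ q)

{-# OPTIONS --safe #-}
-- Upper bound: shrink [n] greedily, dropping a point whenever the smaller set is still answered
-- YES; after n queries this ends at a member A of the antichain. As A ⊈ B, a query missing a
-- point of A is answered YES exactly when it contains B, so shrinking [n] over the points of A,
-- and then the result over the points outside A, recovers B with n further queries.
--
-- Lower bound: a strategy whose runs tell 2-antichains apart separates at most 2 · 2^d ordered
-- incomparable pairs with d queries. For every first query Q one answer class holds more than
-- 4^n / 2 ordered incomparable pairs once n ≥ 11: the YES class when Q misses at most one point,
-- otherwise the NO class of a superset of Q missing exactly two points. The remaining q − 1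
-- queries must separate that class, so 4^n < 2^(q+1), i.e. q ≥ 2n. The classes are counted
-- coordinate by coordinate, tracking which of A ⊆ B, B ⊆ A, A ⊆ Q, B ⊆ Q still hold.
module Submission where

open import Defs
open import Data.Bool using (Bool; true; false; not; if_then_else_; _∧_; _∨_; _≟_)
open import Data.Bool.Properties using (¬-not; ∧-identityʳ; ∨-identityʳ)
open import Data.Empty using (⊥; ⊥-elim)
open import Data.Fin using (Fin; zero; suc)
open import Data.Fin.Subset using (Subset; _⊆_; _-_; ⊤; ∁; ∣_∣)
  renaming (_∈_ to _∈ₛ_; _∉_ to _∉ₛ_)
open import Data.Fin.Subset.Properties
  using (_⊆?_; _∈?_; ⊆-refl; ⊆-trans; ⊆-antisym; ⊆⊤; p─q⊆p; x∈p∧x≢y⇒x∈p-y; s⊆s; out⊆)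
open import Data.List using (List; []; _∷_; length; filter; allFin; map; concatMap)
open import Data.List.Properties
  using (length-tabulate; ∷-injectiveʳ; length-++; length-map; concatMap-cong; map-cong)
open import Data.List.Relation.Unary.Any using (Any; here; there; any?)
open import Data.List.Relation.Unary.All as All using (All; []; _∷_)
open import Data.List.Relation.Unary.All.Properties using (all-filter)
open import Data.List.Relation.Unary.AllPairs using ([]; _∷_)
open import Data.List.Relation.Unary.Unique.Propositional using (Unique)
import Data.List.Relation.Unary.Unique.Propositional.Properties as Unique
open import Data.List.Relation.Binary.Disjoint.Propositional using (Disjoint)
open import Data.List.Relation.Binary.Permutation.Propositional as ↭ using ()
open import Data.List.Relation.Binary.Permutation.Propositional.Properties using (∈-resp-↭)
open import Data.List.Membership.Propositional using (_∈_; find; lose)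
open import Data.List.Membership.Propositional.Properties
  using (∈-allFin; ∈-filter⁺; ∈-filter⁻; ∈-map⁻; ∈-concatMap⁻)
open import Data.Nat using (ℕ; zero; suc; _+_; _*_; _^_; _∸_; _≤_; _<_; _<?_; z≤n; s≤s; s≤s⁻¹; NonZero)
open import Data.Nat.ListAction using (sum)
open import Data.Nat.Properties
  using (≤-refl; ≤-reflexive; ≤-trans; ≤-<-trans; <-≤-trans; n≤1+n; m≤m+n; ≮⇒≥; <⇒≱; m≤n⇒∃[o]m+o≡n;
         +-suc; +-mono-≤; +-monoˡ-≤; +-monoʳ-<; +-cancelˡ-≤; +-cancelʳ-<;
         *-assoc; *-monoˡ-≤; *-monoʳ-≤; *-monoˡ-<; *-monoʳ-<;
         m^n≢0; m^n>0; ^-monoˡ-≤; ^-monoʳ-≤; ^-distribˡ-+-*; ^-*-assoc; ≤ᵇ⇒≤; module ≤-Reasoning)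
open import Data.Nat.Tactic.RingSolver using (solve-∀)
open import Data.Product using (Σ; _×_; _,_; proj₁; proj₂; map₂; swap; uncurry)
open import Data.Sum using (_⊎_; inj₁; inj₂)
open import Data.Vec.Base as Vec using ([]; _∷_)
open import Function using (id; _∘_)
open import Function.Bundles using (mk⇔; Equivalence)
import Function.Properties.Equivalence as ⇔
open import Relation.Binary.PropositionalEquality
  using (_≡_; _≢_; refl; sym; trans; cong; cong₂; subst; subst₂; module ≡-Reasoning)
open import Relation.Nullary using (¬_; yes; no; does; contradiction)
open import Relation.Nullary.Decidable using (dec-true; does-≡; map′)
open import Relation.Unary using (Decidable)
open import Relation.Unary.Properties using (∁?)

private variable
  n : ℕ
  R₁ R₂ : Set

x∉p-x : ∀ (p : Subset n) x → x ∉ₛ p - x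
x∉p-x (_ ∷ p) zero    ()
x∉p-x (_ ∷ p) (suc x) (Vec.there x∈p-x) = x∉p-x p x x∈p-x

p⊆q⇒p-x⊆q-x : ∀ {p q : Subset n} {x} → p ⊆ q → p - x ⊆ q - x
p⊆q⇒p-x⊆q-x {p = p} {x = x} p⊆q y∈p-x =
  x∈p∧x≢y⇒x∈p-y (p⊆q (p─q⊆p p _ y∈p-x)) (λ { refl → x∉p-x p x y∈p-x })

p⊆q∧x∉p⇒p⊆q-x : ∀ {p q : Subset n} {x} → p ⊆ q → x ∉ₛ p → p ⊆ q - x
p⊆q∧x∉p⇒p⊆q-x p⊆q x∉p y∈p = x∈p∧x≢y⇒x∈p-y (p⊆q y∈p) (λ { refl → x∉p y∈p })

∣∁p∣+∣p∣≡n : ∀ (p : Subset n) → ∣ ∁ p ∣ + ∣ p ∣ ≡ n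
∣∁p∣+∣p∣≡n []          = refl
∣∁p∣+∣p∣≡n (true  ∷ p) = trans (+-suc ∣ ∁ p ∣ ∣ p ∣) (cong suc (∣∁p∣+∣p∣≡n p))
∣∁p∣+∣p∣≡n (false ∷ p) = cong suc (∣∁p∣+∣p∣≡n p)

length-allFin : ∀ n → length (allFin n) ≡ n
length-allFin n = length-tabulate id

length-filter-∁ : ∀ {A : Set} {P : A → Set} (P? : Decidable P) xs →
                  length (filter P? xs) + length (filter (∁? P?) xs) ≡ length xs
length-filter-∁ P? []       = refl
length-filter-∁ P? (x ∷ xs) with does (P? x)
... | true  = cong suc (length-filter-∁ P? xs)
... | false = trans (+-suc _ _) (cong suc (length-filter-∁ P? xs))

length-concatMap : ∀ {A B : Set} (f : A → List B) xs → length (concatMap f xs) ≡ sum (map (length ∘ f) xs)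
length-concatMap f []       = refl
length-concatMap f (x ∷ xs) = trans (length-++ (f x)) (cong (length (f x) +_) (length-concatMap f xs))

concatMap-map-unique : ∀ {A B C : Set} (c : A → B → C) →
                       (∀ {a a′ b b′} → c a b ≡ c a′ b′ → a ≡ a′ × b ≡ b′) →
                       ∀ (f : A → List B) {as} → Unique as → (∀ a → Unique (f a)) →
                       Unique (concatMap (λ a → map (c a) (f a)) as)
concatMap-map-unique c c-injective f {[]}     _                  _        = []
concatMap-map-unique c c-injective f {a ∷ as} (a∉as ∷ as-unique) f-unique =
  Unique.++⁺ (Unique.map⁺ (proj₂ ∘ c-injective) (f-unique a))
             (concatMap-map-unique c c-injective f as-unique f-unique) disjoint
  where
  disjoint : Disjoint (map (c a) (f a)) (concatMap (λ a → map (c a) (f a)) as)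
  disjoint (v∈head , v∈rest)
    with ∈-map⁻ (c a) v∈head | find (∈-concatMap⁻ (λ a → map (c a) (f a)) {xs = as} v∈rest)
  ... | _ , _ , refl | a′ , a′∈as , v∈map with ∈-map⁻ (c a′) v∈map
  ...   | _ , _ , eq = All.lookup a∉as a′∈as (proj₁ (c-injective eq))

unique-within-two⇒length≤2 : ∀ {A : Set} {u v : A} {L} → Unique L → (∀ {x} → x ∈ L → x ≡ u ⊎ x ≡ v) →
                             length L ≤ 2
unique-within-two⇒length≤2 {L = []}          _ _ = z≤n
unique-within-two⇒length≤2 {L = _ ∷ []}      _ _ = s≤s z≤n
unique-within-two⇒length≤2 {L = _ ∷ _ ∷ []}  _ _ = s≤s (s≤s z≤n)
unique-within-two⇒length≤2 {u = u} {v} {L = x ∷ y ∷ z ∷ _} ((x≢y ∷ x≢z ∷ _) ∷ (y≢z ∷ _) ∷ _) within =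
  ⊥-elim (three-in-two (within (here refl)) (within (there (here refl))) (within (there (there (here refl)))))
  where
  three-in-two : x ≡ u ⊎ x ≡ v → y ≡ u ⊎ y ≡ v → z ≡ u ⊎ z ≡ v → ⊥
  three-in-two (inj₁ x≡u) (inj₁ y≡u) _          = x≢y (trans x≡u (sym y≡u))
  three-in-two (inj₂ x≡v) (inj₂ y≡v) _          = x≢y (trans x≡v (sym y≡v))
  three-in-two (inj₁ x≡u) (inj₂ _)   (inj₁ z≡u) = x≢z (trans x≡u (sym z≡u))
  three-in-two (inj₂ x≡v) (inj₁ _)   (inj₂ z≡v) = x≢z (trans x≡v (sym z≡v))
  three-in-two (inj₁ _)   (inj₂ y≡v) (inj₂ z≡v) = y≢z (trans y≡v (sym z≡v))
  three-in-two (inj₂ _)   (inj₁ y≡u) (inj₁ z≡u) = y≢z (trans y≡u (sym z≡u))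

sum-map-0 : ∀ {A : Set} (xs : List A) → sum (map (λ _ → 0) xs) ≡ 0
sum-map-0 []       = refl
sum-map-0 (_ ∷ xs) = sum-map-0 xs

sum-map-+ : ∀ {A : Set} (f g : A → ℕ) xs → sum (map f xs) + sum (map g xs) ≡ sum (map (λ x → f x + g x) xs)
sum-map-+ f g []       = refl
sum-map-+ f g (x ∷ xs) = trans (interchange (f x) (g x) _ _) (cong (f x + g x +_) (sum-map-+ f g xs))
  where
  interchange : ∀ a b c d → (a + c) + (b + d) ≡ (a + b) + (c + d)
  interchange = solve-∀

sum-map-swap : ∀ {A B : Set} (t : A → B → ℕ) xs ys →
               sum (map (λ x → sum (map (t x) ys)) xs) ≡ sum (map (λ y → sum (map (λ x → t x y) xs)) ys)
sum-map-swap t []       ys = sym (sum-map-0 ys)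
sum-map-swap t (x ∷ xs) ys = trans (cong (sum (map (t x) ys) +_) (sum-map-swap t xs ys)) (sum-map-+ (t x) _ ys)

length-if-∧ : ∀ {A : Set} {x : A} d w →
              length (if d ∧ w then x ∷ [] else []) ≡ (if d then (if w then 1 else 0) else 0)
length-if-∧ false _     = refl
length-if-∧ true  true  = refl
length-if-∧ true  false = refl

m^n<m^o⇒n<o : ∀ m .{{_ : NonZero m}} {n o} → m ^ n < m ^ o → n < o
m^n<m^o⇒n<o m {n} {o} m^n<m^o with n <? o
... | yes n<o = n<o
... | no  n≮o = contradiction (^-monoʳ-≤ m (≮⇒≥ n≮o)) (<⇒≱ m^n<m^o)

<-by-margin : ∀ {y x s t} → t < x → y + x ≤ s + t → y < s
<-by-margin {y} {x} {s} {t} t<x y+x≤s+t = +-cancelʳ-< t y s (<-≤-trans (+-monoʳ-< y t<x) y+x≤s+t)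

answer-true⁺ : ∀ {𝒮 : Family n} {S Q} → S ∈ 𝒮 → S ⊆ Q → answer 𝒮 Q ≡ true
answer-true⁺ {𝒮 = 𝒮} {Q = Q} S∈𝒮 S⊆Q = dec-true (any? (_⊆? Q) 𝒮) (lose S∈𝒮 S⊆Q)

answer-true⁻ : ∀ (𝒮 : Family n) {Q} → answer 𝒮 Q ≡ true → Any (_⊆ Q) 𝒮
answer-true⁻ 𝒮 {Q} accepted with any? (_⊆? Q) 𝒮
... | yes some = some

answer-mono : ∀ (𝒮 : Family n) {Q Q′} → Q ⊆ Q′ → answer 𝒮 Q ≡ true → answer 𝒮 Q′ ≡ true
answer-mono 𝒮 Q⊆Q′ accepted =
  let S , S∈𝒮 , S⊆Q = find (answer-true⁻ 𝒮 accepted) in answer-true⁺ S∈𝒮 (⊆-trans S⊆Q Q⊆Q′)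

answer-mono-false : ∀ (𝒮 : Family n) {Q Q′} → Q ⊆ Q′ → answer 𝒮 Q′ ≡ false → answer 𝒮 Q ≡ false
answer-mono-false 𝒮 {Q} Q⊆Q′ rejected with answer 𝒮 Q in eq
... | false = refl
... | true  with () ← trans (sym (answer-mono 𝒮 Q⊆Q′ eq)) rejected

answer-pair⁻ : ∀ {A B Q : Subset n} → answer (A ∷ B ∷ []) Q ≡ true → A ⊆ Q ⊎ B ⊆ Q
answer-pair⁻ accepted with answer-true⁻ (_ ∷ _ ∷ []) accepted
... | here A⊆Q         = inj₁ A⊆Q
... | there (here B⊆Q) = inj₂ B⊆Q

any-resp-sameFamily : ∀ {𝒮 𝒯 : Family n} {P : Subset n → Set} → SameFamily 𝒮 𝒯 → Any P 𝒮 → Any P 𝒯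
any-resp-sameFamily 𝒮~𝒯 some = let S , S∈𝒮 , PS = find some in lose (Equivalence.to (𝒮~𝒯 S) S∈𝒮) PS

answer-cong : ∀ {𝒮 𝒯 : Family n} → SameFamily 𝒮 𝒯 → ∀ Q → answer 𝒮 Q ≡ answer 𝒯 Q
answer-cong {𝒮 = 𝒮} {𝒯} 𝒮~𝒯 Q =
  does-≡ (map′ (any-resp-sameFamily 𝒮~𝒯) (any-resp-sameFamily (⇔.sym ∘ 𝒮~𝒯)) (any? (_⊆? Q) 𝒮))
         (any? (_⊆? Q) 𝒯)

sameFamily-swap : ∀ (A B : Subset n) → SameFamily (A ∷ B ∷ []) (B ∷ A ∷ [])
sameFamily-swap A B S = mk⇔ (∈-resp-↭ (↭.swap A B ↭.refl)) (∈-resp-↭ (↭.swap B A ↭.refl))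

-- Query programs

-- A Strategy has no outputs; a query program also returns a value computed from the answers,
-- which strategy forgets.
data Query (n : ℕ) (R : Set) : Set where
  return : R → Query n R
  query  : Subset n → (Bool → Query n R) → Query n R

_>>=_ : Query n R₁ → (R₁ → Query n R₂) → Query n R₂
return r  >>= k = k r
query Q c >>= k = query Q (λ b → c b >>= k)

strategy : Query n R₁ → Strategy n
strategy (return _)  = stop
strategy (query Q c) = ask Q (strategy (c true)) (strategy (c false))

eval : Query n R₁ → Family n → R₁
eval (return r)  𝒮 = r
eval (query Q c) 𝒮 = eval (c (answer 𝒮 Q)) 𝒮

cost : Query n R₁ → Family n → ℕ
cost (return _)  𝒮 = 0
cost (query Q c) 𝒮 = suc (cost (c (answer 𝒮 Q)) 𝒮)

run-ask : ∀ (𝒮 : Family n) Q y m → run (ask Q y m) 𝒮 ≡ answer 𝒮 Q ∷ run (if answer 𝒮 Q then y else m) 𝒮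
run-ask 𝒮 Q y m with answer 𝒮 Q
... | true  = refl
... | false = refl

eval-determined : ∀ (t : Query n R₁) 𝒮 𝒯 → run (strategy t) 𝒮 ≡ run (strategy t) 𝒯 → eval t 𝒮 ≡ eval t 𝒯
eval-determined (return r)  𝒮 𝒯 _ = refl
eval-determined (query Q c) 𝒮 𝒯 same-run with answer 𝒮 Q | answer 𝒯 Q
... | true  | true  = eval-determined (c true) 𝒮 𝒯 (∷-injectiveʳ same-run)
... | false | false = eval-determined (c false) 𝒮 𝒯 (∷-injectiveʳ same-run)
eval-determined (query Q c) 𝒮 𝒯 () | true  | false
eval-determined (query Q c) 𝒮 𝒯 () | false | true

length-run-strategy : ∀ (t : Query n R₁) 𝒮 → length (run (strategy t) 𝒮) ≡ cost t 𝒮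
length-run-strategy (return _)  𝒮 = refl
length-run-strategy (query Q c) 𝒮 with answer 𝒮 Q
... | true  = cong suc (length-run-strategy (c true) 𝒮)
... | false = cong suc (length-run-strategy (c false) 𝒮)

eval-cong : ∀ (t : Query n R₁) {𝒮 𝒯} → (∀ Q → answer 𝒮 Q ≡ answer 𝒯 Q) → eval t 𝒮 ≡ eval t 𝒯
eval-cong (return r)  _    = refl
eval-cong (query Q c) same rewrite same Q = eval-cong (c _) same

eval->>= : ∀ (t : Query n R₁) (k : R₁ → Query n R₂) 𝒮 → eval (t >>= k) 𝒮 ≡ eval (k (eval t 𝒮)) 𝒮
eval->>= (return r)  k 𝒮 = refl
eval->>= (query Q c) k 𝒮 = eval->>= (c (answer 𝒮 Q)) k 𝒮

cost->>= : ∀ (t : Query n R₁) (k : R₁ → Query n R₂) 𝒮 →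
           cost (t >>= k) 𝒮 ≡ cost t 𝒮 + cost (k (eval t 𝒮)) 𝒮
cost->>= (return r)  k 𝒮 = refl
cost->>= (query Q c) k 𝒮 = cong suc (cost->>= (c (answer 𝒮 Q)) k 𝒮)

shrink : List (Fin n) → Subset n → Query n (Subset n)
shrink []       W = return W
shrink (i ∷ is) W = query (W - i) (λ accepted → shrink is (if accepted then W - i else W))

cost-shrink : ∀ (is : List (Fin n)) W 𝒮 → cost (shrink is W) 𝒮 ≡ length is
cost-shrink []       W 𝒮 = refl
cost-shrink (i ∷ is) W 𝒮 = cong suc (cost-shrink is _ 𝒮)

shrink-⊆ : ∀ (is : List (Fin n)) W 𝒮 → eval (shrink is W) 𝒮 ⊆ W
shrink-⊆ []       W 𝒮 = id
shrink-⊆ (i ∷ is) W 𝒮 with answer 𝒮 (W - i)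
... | true  = ⊆-trans (shrink-⊆ is (W - i) 𝒮) (p─q⊆p W _)
... | false = shrink-⊆ is W 𝒮

shrink-accepted : ∀ (is : List (Fin n)) W 𝒮 → answer 𝒮 W ≡ true → answer 𝒮 (eval (shrink is W) 𝒮) ≡ true
shrink-accepted []       W 𝒮 accepted = accepted
shrink-accepted (i ∷ is) W 𝒮 accepted with answer 𝒮 (W - i) in eq
... | true  = shrink-accepted is (W - i) 𝒮 eq
... | false = shrink-accepted is W 𝒮 accepted

shrink-minimal : ∀ (is : List (Fin n)) W 𝒮 → answer 𝒮 W ≡ true → ∀ {j} → j ∈ is →
                 j ∈ₛ eval (shrink is W) 𝒮 → answer 𝒮 (eval (shrink is W) 𝒮 - j) ≡ false
shrink-minimal (i ∷ is) W 𝒮 accepted j∈is j∈X with answer 𝒮 (W - i) in eq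
shrink-minimal (i ∷ is) W 𝒮 accepted (here refl) j∈X | true  =
  ⊥-elim (x∉p-x W i (shrink-⊆ is (W - i) 𝒮 j∈X))
shrink-minimal (i ∷ is) W 𝒮 accepted (there j∈is) j∈X | true  = shrink-minimal is (W - i) 𝒮 eq j∈is j∈X
shrink-minimal (i ∷ is) W 𝒮 accepted (here refl) j∈X | false =
  answer-mono-false 𝒮 (p⊆q⇒p-x⊆q-x (shrink-⊆ is W 𝒮)) eq
shrink-minimal (i ∷ is) W 𝒮 accepted (there j∈is) j∈X | false = shrink-minimal is W 𝒮 accepted j∈is j∈X

minimal-accepted-∈ : ∀ (𝒮 : Family n) {X} → answer 𝒮 X ≡ true →
                     (∀ {j} → j ∈ₛ X → answer 𝒮 (X - j) ≡ false) → X ∈ 𝒮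
minimal-accepted-∈ 𝒮 {X} accepted minimal with find (answer-true⁻ 𝒮 accepted)
... | S , S∈𝒮 , S⊆X = subst (_∈ 𝒮) (⊆-antisym S⊆X X⊆S) S∈𝒮
  where
  X⊆S : X ⊆ S
  X⊆S {j} j∈X with j ∈? S
  ... | yes j∈S = j∈S
  ... | no  j∉S = contradiction (trans (sym (answer-true⁺ S∈𝒮 (p⊆q∧x∉p⇒p⊆q-x S⊆X j∉S))) (minimal j∈X)) λ ()

shrink-recovers-target : ∀ (is : List (Fin n)) W 𝒮 {T} → T ⊆ W → (∀ {Q} → T ⊆ Q → answer 𝒮 Q ≡ true) →
                         (∀ {V i} → i ∈ is → V ⊆ W → answer 𝒮 (V - i) ≡ true → T ⊆ V - i) →
                         T ⊆ eval (shrink is W) 𝒮 × (∀ {j} → j ∈ is → j ∈ₛ eval (shrink is W) 𝒮 → j ∈ₛ T)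
shrink-recovers-target []       W 𝒮 T⊆W _ _ = T⊆W , λ ()
shrink-recovers-target (i ∷ is) W 𝒮 {T} T⊆W T-accepted only-T with answer 𝒮 (W - i) in eq
... | true  = proj₁ rest , λ where
      (here refl)  j∈X → ⊥-elim (x∉p-x W i (shrink-⊆ is (W - i) 𝒮 j∈X))
      (there j∈is) j∈X → proj₂ rest j∈is j∈X
  where
  rest : T ⊆ eval (shrink is (W - i)) 𝒮 × (∀ {j} → j ∈ is → j ∈ₛ eval (shrink is (W - i)) 𝒮 → j ∈ₛ T)
  rest = shrink-recovers-target is (W - i) 𝒮 (only-T (here refl) ⊆-refl eq) T-accepted
           (λ i∈is V⊆W-i → only-T (there i∈is) (⊆-trans V⊆W-i (p─q⊆p W _)))
... | false = proj₁ rest , λ where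
      (here refl)  _   → i∈T
      (there j∈is) j∈X → proj₂ rest j∈is j∈X
  where
  rest : T ⊆ eval (shrink is W) 𝒮 × (∀ {j} → j ∈ is → j ∈ₛ eval (shrink is W) 𝒮 → j ∈ₛ T)
  rest = shrink-recovers-target is W 𝒮 T⊆W T-accepted (only-T ∘ there)
  i∈T : i ∈ₛ T
  i∈T with i ∈? T
  ... | yes i∈T = i∈T
  ... | no  i∉T = contradiction (trans (sym (T-accepted (p⊆q∧x∉p⇒p⊆q-x T⊆W i∉T))) eq) λ ()

-- The upper bound

members nonmembers : Subset n → List (Fin n)
members    A = filter (_∈? A) (allFin _)
nonmembers A = filter (∁? (_∈? A)) (allFin _)

findPartner : Subset n → Query n (Subset n)
findPartner A = shrink (members A) ⊤ >>= shrink (nonmembers A)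

findPartner-correct : ∀ {A B : Subset n} → ¬ A ⊆ B → eval (findPartner A) (A ∷ B ∷ []) ≡ B
findPartner-correct {n} {A} {B} A⊈B =
  trans (eval->>= (shrink (members A) ⊤) (shrink (nonmembers A)) 𝒮) (⊆-antisym Y⊆B (proj₁ phase₂))
  where
  𝒮 = A ∷ B ∷ []
  R = eval (shrink (members A) ⊤) 𝒮
  Y = eval (shrink (nonmembers A) R) 𝒮
  B-accepted : ∀ {Q} → B ⊆ Q → answer 𝒮 Q ≡ true
  B-accepted = answer-true⁺ {𝒮 = 𝒮} (there (here refl))
  only-B : ∀ {Q} → ¬ A ⊆ Q → answer 𝒮 Q ≡ true → B ⊆ Q
  only-B A⊈Q accepted with answer-pair⁻ {A = A} accepted
  ... | inj₁ A⊆Q = ⊥-elim (A⊈Q A⊆Q)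
  ... | inj₂ B⊆Q = B⊆Q
  phase₁ : B ⊆ R × (∀ {j} → j ∈ members A → j ∈ₛ R → j ∈ₛ B)
  phase₁ = shrink-recovers-target (members A) ⊤ 𝒮 ⊆⊤ B-accepted
             (λ i∈A _ → only-B (λ A⊆V-i → x∉p-x _ _ (A⊆V-i (proj₂ (∈-filter⁻ (_∈? A) {xs = allFin n} i∈A)))))
  -- R agrees with B on A, so A ⊈ R and the second sweep, which stays inside R, only sees B.
  A⊈R : ¬ A ⊆ R
  A⊈R A⊆R = A⊈B (λ j∈A → proj₂ phase₁ (∈-filter⁺ (_∈? A) (∈-allFin _) j∈A) (A⊆R j∈A))
  phase₂ : B ⊆ Y × (∀ {j} → j ∈ nonmembers A → j ∈ₛ Y → j ∈ₛ B)
  phase₂ = shrink-recovers-target (nonmembers A) R 𝒮 (proj₁ phase₁) B-accepted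
             (λ _ V⊆R → only-B (λ A⊆V-i → A⊈R (⊆-trans A⊆V-i (⊆-trans (p─q⊆p _ _) V⊆R))))
  Y⊆B : Y ⊆ B
  Y⊆B {j} j∈Y with j ∈? A
  ... | yes j∈A = proj₂ phase₁ (∈-filter⁺ (_∈? A) (∈-allFin j) j∈A) (shrink-⊆ (nonmembers A) R 𝒮 j∈Y)
  ... | no  j∉A = proj₂ phase₂ (∈-filter⁺ (∁? (_∈? A)) (∈-allFin j) j∉A) j∈Y

cost-findPartner : ∀ (A : Subset n) 𝒮 → cost (findPartner A) 𝒮 ≡ n
cost-findPartner {n} A 𝒮 = begin
  cost (findPartner A) 𝒮                      ≡⟨ cost->>= (shrink (members A) ⊤) (shrink (nonmembers A)) 𝒮 ⟩
  cost (shrink (members A) ⊤) 𝒮 + cost (shrink (nonmembers A) _) 𝒮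
                                             ≡⟨ cong₂ _+_ (cost-shrink (members A) ⊤ 𝒮) (cost-shrink (nonmembers A) _ 𝒮) ⟩
  length (members A) + length (nonmembers A) ≡⟨ length-filter-∁ (_∈? A) (allFin n) ⟩
  length (allFin n)                          ≡⟨ length-allFin n ⟩
  n                                          ∎
  where open ≡-Reasoning

decode : Query n (Family n)
decode {n} = do
  X ← shrink (allFin n) ⊤
  Y ← findPartner X
  return (X ∷ Y ∷ [])

eval-decode : ∀ (𝒮 : Family n) → let X = eval (shrink (allFin n) ⊤) 𝒮 in
              eval decode 𝒮 ≡ X ∷ eval (findPartner X) 𝒮 ∷ []
eval-decode {n} 𝒮 =
  trans (eval->>= (shrink (allFin n) ⊤) _ 𝒮) (eval->>= (findPartner (eval (shrink (allFin n) ⊤) 𝒮)) _ 𝒮)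

sameFamily-with-partner : ∀ {A B X : Subset n} → ¬ A ⊆ B → ¬ B ⊆ A → X ∈ A ∷ B ∷ [] →
                          SameFamily (A ∷ B ∷ []) (X ∷ eval (findPartner X) (A ∷ B ∷ []) ∷ [])
sameFamily-with-partner A⊈B B⊈A (here refl) rewrite findPartner-correct A⊈B = λ _ → ⇔.refl
sameFamily-with-partner {A = A} {B} A⊈B B⊈A (there (here refl)) =
  subst (λ Y → SameFamily (A ∷ B ∷ []) (B ∷ Y ∷ [])) (sym partner≡A) (sameFamily-swap A B)
  where
  partner≡A : eval (findPartner B) (A ∷ B ∷ []) ≡ A
  partner≡A = trans (eval-cong (findPartner B) (answer-cong (sameFamily-swap A B))) (findPartner-correct B⊈A)

decode-correct : ∀ {𝒮 : Family n} → IsAntichain 2 𝒮 → SameFamily 𝒮 (eval decode 𝒮)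
decode-correct {n} {𝒮 = 𝒮@(A ∷ B ∷ [])} (_ , ((_ , A⊈B , B⊈A) ∷ []) ∷ [] ∷ []) rewrite eval-decode 𝒮 =
  sameFamily-with-partner A⊈B B⊈A
    (minimal-accepted-∈ 𝒮 (shrink-accepted (allFin n) ⊤ 𝒮 accepted)
                          (shrink-minimal (allFin n) ⊤ 𝒮 accepted (∈-allFin _)))
  where
  accepted : answer 𝒮 ⊤ ≡ true
  accepted = answer-true⁺ {𝒮 = 𝒮} (here refl) ⊆⊤

decode-determines : Determines {n} 2 (strategy decode)
decode-determines 𝒮 𝒯 𝒮-antichain 𝒯-antichain same-run S
  with eval decode 𝒮 | eval-determined decode 𝒮 𝒯 same-run | decode-correct 𝒮-antichain S
... | _ | refl | S∈𝒮⇔ = ⇔.trans S∈𝒮⇔ (⇔.sym (decode-correct 𝒯-antichain S))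

cost-decode : ∀ (𝒮 : Family n) → cost decode 𝒮 ≡ 2 * n
cost-decode {n} 𝒮 =
  trans (cost->>= (shrink (allFin n) ⊤) _ 𝒮)
        (cong₂ _+_ (trans (cost-shrink (allFin n) ⊤ 𝒮) (length-allFin n))
                   (trans (cost->>= (findPartner X) _ 𝒮) (cong (_+ 0) (cost-findPartner X 𝒮))))
  where
  X = eval (shrink (allFin n) ⊤) 𝒮

upper-bound : Achievable n 2 (2 * n)
upper-bound = strategy decode , decode-determines ,
              λ 𝒮 _ → ≤-reflexive (trans (length-run-strategy decode 𝒮) (cost-decode 𝒮))

-- Separating ordered pairs

Pair : ℕ → Set
Pair n = Subset n × Subset n

pairFamily : Pair n → Family n
pairFamily (A , B) = A ∷ B ∷ []

Incomparable : Pair n → Set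
Incomparable (A , B) = ¬ A ⊆ B × ¬ B ⊆ A

incomparable⇒antichain : ∀ {p : Pair n} → Incomparable p → IsAntichain 2 (pairFamily p)
incomparable⇒antichain {p = A , B} (A⊈B , B⊈A) = refl , ((A≢B , A⊈B , B⊈A) ∷ []) ∷ [] ∷ []
  where
  A≢B : A ≢ B
  A≢B refl = A⊈B id

sameFamily-pairFamily : ∀ {p q : Pair n} → Incomparable q → SameFamily (pairFamily p) (pairFamily q) →
                        q ≡ p ⊎ q ≡ swap p
sameFamily-pairFamily {q = C , D} (C⊈D , _) same
  with Equivalence.from (same C) (here refl) | Equivalence.from (same D) (there (here refl))
... | here refl         | there (here refl) = inj₁ refl
... | there (here refl) | here refl         = inj₂ refl
... | here refl         | here refl         = ⊥-elim (C⊈D id)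
... | there (here refl) | there (here refl) = ⊥-elim (C⊈D id)

Separates : Strategy n → List (Pair n) → Set
Separates T L = ∀ {p q} → p ∈ L → q ∈ L → run T (pairFamily p) ≡ run T (pairFamily q) → q ≡ p ⊎ q ≡ swap p

Depth≤ : Strategy n → ℕ → List (Pair n) → Set
Depth≤ T d L = All (λ p → length (run T (pairFamily p)) ≤ d) L

determines⇒separates : ∀ {T : Strategy n} {L} → Determines 2 T → All Incomparable L → Separates T L
determines⇒separates determines incomparable p∈L q∈L same-run =
  sameFamily-pairFamily (All.lookup incomparable q∈L)
    (determines _ _ (incomparable⇒antichain (All.lookup incomparable p∈L))
                    (incomparable⇒antichain (All.lookup incomparable q∈L)) same-run)

separates-⊆ : ∀ {T : Strategy n} {L L′} → (∀ {p} → p ∈ L′ → p ∈ L) → Separates T L → Separates T L′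
separates-⊆ L′⊆L separates p∈L′ q∈L′ = separates (L′⊆L p∈L′) (L′⊆L q∈L′)

module _ {Q : Subset n} (y m : Strategy n) {a : Bool} {L : List (Pair n)}
         (answers-a : All (λ p → answer (pairFamily p) Q ≡ a) L) where

  private
    run-branch : ∀ {p} → p ∈ L → run (ask Q y m) (pairFamily p) ≡ a ∷ run (if a then y else m) (pairFamily p)
    run-branch {p} p∈L rewrite run-ask (pairFamily p) Q y m | All.lookup answers-a p∈L = refl

  separates-branch : Separates (ask Q y m) L → Separates (if a then y else m) L
  separates-branch separates p∈L q∈L same-run =
    separates p∈L q∈L (trans (run-branch p∈L) (trans (cong (a ∷_) same-run) (sym (run-branch q∈L))))

  depth-branch : ∀ {d} → Depth≤ (ask Q y m) (suc d) L → Depth≤ (if a then y else m) d L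
  depth-branch depth =
    All.tabulate λ p∈L → s≤s⁻¹ (subst (λ r → length r ≤ _) (run-branch p∈L) (All.lookup depth p∈L))

separation-bound : ∀ (T : Strategy n) d {L} → Unique L → Separates T L → Depth≤ T d L → length L ≤ 2 * 2 ^ d
separation-bound stop d {[]}    _      _         _ = z≤n
separation-bound stop d {_ ∷ _} unique separates _ =
  ≤-trans (unique-within-two⇒length≤2 unique (λ q∈L → separates (here refl) q∈L refl)) (*-monoʳ-≤ 2 (m^n>0 2 d))
separation-bound (ask Q y m) zero {[]}    _ _ _ = z≤n
separation-bound (ask Q y m) zero {p ∷ _} _ _ (depth ∷ _) rewrite run-ask (pairFamily p) Q y m with () ← depth
separation-bound {n} (ask Q y m) (suc d) {L} unique separates depth = begin
  length L                                             ≡⟨ length-filter-∁ accepts? L ⟨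
  length (filter accepts? L) + length (filter (∁? accepts?) L)
    ≤⟨ +-mono-≤ (uncurry (separation-bound y d (Unique.filter⁺ accepts? unique))
                         (restrict (proj₁ ∘ ∈-filter⁻ accepts?) (all-filter accepts? L)))
                (uncurry (separation-bound m d (Unique.filter⁺ (∁? accepts?) unique))
                         (restrict (proj₁ ∘ ∈-filter⁻ (∁? accepts?)) (All.map ¬-not (all-filter (∁? accepts?) L)))) ⟩
  2 * 2 ^ d + 2 * 2 ^ d                                ≡⟨ double (2 ^ d) ⟩
  2 * 2 ^ suc d                                        ∎
  where
  open ≤-Reasoning
  accepts? : Decidable (λ (p : Pair n) → answer (pairFamily p) Q ≡ true)
  accepts? p = answer (pairFamily p) Q ≟ true
  restrict : ∀ {a L′} → (∀ {p} → p ∈ L′ → p ∈ L) → All (λ p → answer (pairFamily p) Q ≡ a) L′ →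
             Separates (if a then y else m) L′ × Depth≤ (if a then y else m) d L′
  restrict L′⊆L answers =
    separates-branch y m answers (separates-⊆ {T = ask Q y m} L′⊆L separates) ,
    depth-branch y m answers (All.tabulate (All.lookup depth ∘ L′⊆L))
  double : ∀ x → 2 * x + 2 * x ≡ 2 * (2 * x)
  double = solve-∀

-- stop asks nothing, so its first query is an arbitrary choice.
firstQuery : Strategy n → Subset n
firstQuery stop        = ⊤
firstQuery (ask Q _ _) = Q

fixed-first-answer-bound : ∀ (T : Strategy n) q {a L} → Unique L →
                           All (λ p → answer (pairFamily p) (firstQuery T) ≡ a) L →
                           Separates T L → Depth≤ T q L → length L ≤ 2 * 2 ^ (q ∸ 1)
fixed-first-answer-bound stop        q       unique _ separates _ =
  separation-bound stop (q ∸ 1) unique separates (All.tabulate λ _ → z≤n)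
fixed-first-answer-bound (ask Q y m) zero    unique _ separates depth =
  separation-bound (ask Q y m) 0 unique separates depth
fixed-first-answer-bound (ask Q y m) (suc d) {a} unique answers separates depth =
  separation-bound (if a then y else m) d unique (separates-branch y m answers separates) (depth-branch y m answers depth)

query-count-bound : ∀ {n q ℓ} → 1 ≤ n → 4 ^ n < 2 * ℓ → ℓ ≤ 2 * 2 ^ (q ∸ 1) → 2 * n ≤ q
query-count-bound {n} {q} {ℓ} n≥1 large bound = from-exponents q (m^n<m^o⇒n<o 2 (begin-strict
  2 ^ (2 * n)      ≡⟨ ^-*-assoc 2 2 n ⟨
  4 ^ n            <⟨ large ⟩
  2 * ℓ            ≤⟨ *-monoʳ-≤ 2 bound ⟩
  2 ^ (2 + (q ∸ 1)) ∎))
  where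
  open ≤-Reasoning
  from-exponents : ∀ r → 2 * n < 2 + (r ∸ 1) → 2 * n ≤ r
  from-exponents (suc _) 2n<1+r = s≤s⁻¹ 2n<1+r
  from-exponents zero    2n<2   = ⊥-elim (<⇒≱ 2n<2 (*-monoʳ-≤ 2 n≥1))

-- Counting answer classes

cons : Bool × Bool → Pair n → Pair (suc n)
cons (x , y) (A , B) = x ∷ A , y ∷ B

cons-injective : ∀ {h h′ : Bool × Bool} {p p′ : Pair n} → cons h p ≡ cons h′ p′ → h ≡ h′ × p ≡ p′
cons-injective {h = _ , _} {_ , _} {_ , _} {_ , _} refl = refl , refl

bits² : List (Bool × Bool)
bits² = (false , false) ∷ (false , true) ∷ (true , false) ∷ (true , true) ∷ []

bits²-unique : Unique bits²
bits²-unique = ((λ ()) ∷ (λ ()) ∷ (λ ()) ∷ []) ∷ ((λ ()) ∷ (λ ()) ∷ []) ∷ ((λ ()) ∷ []) ∷ [] ∷ []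

Σ² : (Bool × Bool → ℕ) → ℕ
Σ² f = sum (map f bits²)

Σ²-cong : ∀ {f g : Bool × Bool → ℕ} → (∀ h → f h ≡ g h) → Σ² f ≡ Σ² g
Σ²-cong f≗g = cong sum (map-cong f≗g bits²)

pairsWhere : (Pair n → Bool) → List (Pair n)
pairsWhere {zero}  P = if P ([] , []) then ([] , []) ∷ [] else []
pairsWhere {suc n} P = concatMap (λ h → map (cons h) (pairsWhere (P ∘ cons h))) bits²

pairsWhere-unique : ∀ (P : Pair n → Bool) → Unique (pairsWhere P)
pairsWhere-unique {zero} P with P ([] , [])
... | true  = [] ∷ []
... | false = []
pairsWhere-unique {suc n} P =
  concatMap-map-unique cons cons-injective (λ h → pairsWhere (P ∘ cons h)) bits²-unique
                       (λ h → pairsWhere-unique (P ∘ cons h))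

∈-pairsWhere⁻ : ∀ {P : Pair n → Bool} {p} → p ∈ pairsWhere P → P p ≡ true
∈-pairsWhere⁻ {zero} {P} p∈ with P ([] , []) in eq
∈-pairsWhere⁻ {zero} {P} (here refl) | true = eq
∈-pairsWhere⁻ {suc n} {P} p∈
  with find (∈-concatMap⁻ (λ h → map (cons h) (pairsWhere (P ∘ cons h))) {xs = bits²} p∈)
... | h , _ , p∈map with ∈-map⁻ (cons h) p∈map
...   | _ , p′∈ , refl = ∈-pairsWhere⁻ p′∈

pairsWhere-cong : ∀ {P P′ : Pair n → Bool} → (∀ p → P p ≡ P′ p) → pairsWhere P ≡ pairsWhere P′
pairsWhere-cong {zero}  P≗P′ rewrite P≗P′ ([] , []) = refl
pairsWhere-cong {suc n} P≗P′ = concatMap-cong (λ h → cong (map (cons h)) (pairsWhere-cong (P≗P′ ∘ cons h))) bits²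

length-pairsWhere : ∀ (P : Pair (suc n) → Bool) → length (pairsWhere P) ≡ Σ² (λ h → length (pairsWhere (P ∘ cons h)))
length-pairsWhere P =
  trans (length-concatMap (λ h → map (cons h) (pairsWhere (P ∘ cons h))) bits²)
        (Σ²-cong (λ h → length-map (cons h) (pairsWhere (P ∘ cons h))))

_⊆ᵇ_ : Subset n → Subset n → Bool
A ⊆ᵇ B = does (A ⊆? B)

_⇒ᵇ_ : Bool → Bool → Bool
x ⇒ᵇ y = not x ∨ y

⊆ᵇ-∷ : ∀ x y (A B : Subset n) → (x ∷ A) ⊆ᵇ (y ∷ B) ≡ (x ⇒ᵇ y) ∧ A ⊆ᵇ B
⊆ᵇ-∷ false y     A B = refl
⊆ᵇ-∷ true  false A B = refl
⊆ᵇ-∷ true  true  A B = refl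

∧-exchange : ∀ u c a → (u ∧ c) ∧ a ≡ c ∧ (u ∧ a)
∧-exchange true  c     a = refl
∧-exchange false false a = refl
∧-exchange false true  a = refl

-- Which inclusions hold on the coordinates read so far.
data Inclusions : Set where
  inclusions : (A⊆B B⊆A A⊆Q B⊆Q : Bool) → Inclusions

allHold : Inclusions
allHold = inclusions true true true true

-- The new bit comes first so that, for concrete bits, each field reduces to the old one or to
-- false; hence steps commute definitionally.
step : Bool → Bool × Bool → Inclusions → Inclusions
step q (x , y) (inclusions ab ba aq bq) =
  inclusions ((x ⇒ᵇ y) ∧ ab) ((y ⇒ᵇ x) ∧ ba) ((x ⇒ᵇ q) ∧ aq) ((y ⇒ᵇ q) ∧ bq)

-- Whether the pair, appended to a prefix with inclusions s, is incomparable and answers a to Q.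
classify : Bool → Subset n → Inclusions → Pair n → Bool
classify a Q (inclusions ab ba aq bq) (A , B) =
  does ((A ⊆ᵇ Q ∧ aq) ∨ (B ⊆ᵇ Q ∧ bq) ≟ a) ∧ not (A ⊆ᵇ B ∧ ab) ∧ not (B ⊆ᵇ A ∧ ba)

classify-cons : ∀ a q (Q : Subset n) s h p → classify a (q ∷ Q) s (cons h p) ≡ classify a Q (step q h s) p
classify-cons a q Q (inclusions ab ba aq bq) (x , y) (A , B)
  rewrite ⊆ᵇ-∷ x y A B | ⊆ᵇ-∷ y x B A | ⊆ᵇ-∷ x q A Q | ⊆ᵇ-∷ y q B Q
        | ∧-exchange (x ⇒ᵇ y) (A ⊆ᵇ B) ab | ∧-exchange (y ⇒ᵇ x) (B ⊆ᵇ A) ba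
        | ∧-exchange (x ⇒ᵇ q) (A ⊆ᵇ Q) aq | ∧-exchange (y ⇒ᵇ q) (B ⊆ᵇ Q) bq = refl

answer-pairFamily : ∀ (A B Q : Subset n) → answer (pairFamily (A , B)) Q ≡ A ⊆ᵇ Q ∨ B ⊆ᵇ Q
answer-pairFamily A B Q = cong (A ⊆ᵇ Q ∨_) (∨-identityʳ (B ⊆ᵇ Q))

classify-sound : ∀ a (Q : Subset n) {p} → classify a Q allHold p ≡ true →
                 Incomparable p × answer (pairFamily p) Q ≡ a
classify-sound a Q {A , B} accepted
  rewrite ∧-identityʳ (A ⊆ᵇ Q) | ∧-identityʳ (B ⊆ᵇ Q) | ∧-identityʳ (A ⊆ᵇ B) | ∧-identityʳ (B ⊆ᵇ A)
  with A ⊆? B | B ⊆? A | (A ⊆ᵇ Q ∨ B ⊆ᵇ Q) ≟ a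
... | no A⊈B | no B⊈A | yes answers-a = (A⊈B , B⊈A) , trans (answer-pairFamily A B Q) answers-a

-- Pairs over j coordinates refuting each inclusion whose flag is true.
incomparableCount : Bool → Bool → ℕ → ℕ
incomparableCount ab ba zero    = if not ab ∧ not ba then 1 else 0
incomparableCount ab ba (suc j) = Σ² λ (x , y) → incomparableCount ((x ⇒ᵇ y) ∧ ab) ((y ⇒ᵇ x) ∧ ba) j

-- The number of pairs accepted by classify a for a query missing z points followed by j present
-- ones; by classCount-inside the order of the points is irrelevant.
classCount : Bool → Inclusions → ℕ → ℕ → ℕ
classCount a s                        j (suc z) = Σ² λ h → classCount a (step false h s) j z
classCount a (inclusions ab ba aq bq) j zero    = if does ((aq ∨ bq) ≟ a) then incomparableCount ab ba j else 0

classCount-inside : ∀ a s j z → classCount a s (suc j) z ≡ Σ² λ h → classCount a (step true h s) j z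
classCount-inside a (inclusions ab ba aq bq) j zero with does ((aq ∨ bq) ≟ a)
... | true  = refl
... | false = refl
classCount-inside a s@(inclusions _ _ _ _) j (suc z) =
  trans (Σ²-cong λ h → classCount-inside a (step false h s) j z)
        (sum-map-swap (λ h h′ → classCount a (step true h′ (step false h s)) j z) bits² bits²)

length-classify : ∀ a (Q : Subset n) s → length (pairsWhere (classify a Q s)) ≡ classCount a s ∣ Q ∣ ∣ ∁ Q ∣
length-classify a []      (inclusions ab ba aq bq) = length-if-∧ (does ((aq ∨ bq) ≟ a)) (not ab ∧ not ba)
length-classify a (q ∷ Q) s = begin
  length (pairsWhere (classify a (q ∷ Q) s))                   ≡⟨ length-pairsWhere (classify a (q ∷ Q) s) ⟩
  Σ² (λ h → length (pairsWhere (classify a (q ∷ Q) s ∘ cons h))) ≡⟨ Σ²-cong (λ h → cong length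
                                                                     (pairsWhere-cong (classify-cons a q Q s h))) ⟩
  Σ² (λ h → length (pairsWhere (classify a Q (step q h s))))     ≡⟨ Σ²-cong (λ h → length-classify a Q (step q h s)) ⟩
  Σ² (λ h → classCount a (step q h s) ∣ Q ∣ ∣ ∁ Q ∣)              ≡⟨ classCount-step q ⟩
  classCount a s ∣ q ∷ Q ∣ ∣ ∁ (q ∷ Q) ∣                          ∎
  where
  open ≡-Reasoning
  classCount-step : ∀ q → Σ² (λ h → classCount a (step q h s) ∣ Q ∣ ∣ ∁ Q ∣) ≡
                          classCount a s ∣ q ∷ Q ∣ ∣ ∁ (q ∷ Q) ∣
  classCount-step false = refl
  classCount-step true  = sym (classCount-inside a s ∣ Q ∣ ∣ ∁ Q ∣)

incomparableCount-ff : ∀ j → incomparableCount false false j ≡ 4 ^ j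
incomparableCount-ff zero    = refl
incomparableCount-ff (suc j) rewrite incomparableCount-ff j = quadruple (4 ^ j)
  where
  quadruple : ∀ x → x + (x + (x + (x + 0))) ≡ 4 * x
  quadruple = solve-∀

incomparableCount-tf : ∀ j → incomparableCount true false j + 3 ^ j ≡ 4 ^ j
incomparableCount-tf zero    = refl
incomparableCount-tf (suc j) = begin
  v + (v + (x + (v + 0))) + 3 * t ≡⟨ regroup v x t ⟩
  3 * (v + t) + x                 ≡⟨ cong₂ _+_ (cong (3 *_) (incomparableCount-tf j)) (incomparableCount-ff j) ⟩
  3 * 4 ^ j + 4 ^ j               ≡⟨ collect (4 ^ j) ⟩
  4 * 4 ^ j                       ∎
  where
  open ≡-Reasoning
  v = incomparableCount true false j
  x = incomparableCount false false j
  t = 3 ^ j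
  regroup : ∀ v x t → v + (v + (x + (v + 0))) + 3 * t ≡ 3 * (v + t) + x
  regroup = solve-∀
  collect : ∀ x → 3 * x + x ≡ 4 * x
  collect = solve-∀

incomparableCount-ft : ∀ j → incomparableCount false true j + 3 ^ j ≡ 4 ^ j
incomparableCount-ft zero    = refl
incomparableCount-ft (suc j) = begin
  w + (x + (w + (w + 0))) + 3 * t ≡⟨ regroup w x t ⟩
  3 * (w + t) + x                 ≡⟨ cong₂ _+_ (cong (3 *_) (incomparableCount-ft j)) (incomparableCount-ff j) ⟩
  3 * 4 ^ j + 4 ^ j               ≡⟨ collect (4 ^ j) ⟩
  4 * 4 ^ j                       ∎
  where
  open ≡-Reasoning
  w = incomparableCount false true j
  x = incomparableCount false false j
  t = 3 ^ j
  regroup : ∀ w x t → w + (x + (w + (w + 0))) + 3 * t ≡ 3 * (w + t) + x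
  regroup = solve-∀
  collect : ∀ x → 3 * x + x ≡ 4 * x
  collect = solve-∀

incomparableCount-tt : ∀ j → incomparableCount true true j + 2 * 3 ^ j ≡ 4 ^ j + 2 ^ j
incomparableCount-tt zero    = refl
incomparableCount-tt (suc j) = begin
  u + (v + (w + (u + 0))) + 2 * (3 * t)   ≡⟨ regroup u v w t ⟩
  2 * (u + 2 * t) + (v + t) + (w + t)     ≡⟨ cong₂ _+_ (cong₂ _+_ (cong (2 *_) (incomparableCount-tt j))
                                                                  (incomparableCount-tf j))
                                                       (incomparableCount-ft j) ⟩
  2 * (4 ^ j + 2 ^ j) + 4 ^ j + 4 ^ j     ≡⟨ collect (4 ^ j) (2 ^ j) ⟩
  4 * 4 ^ j + 2 * 2 ^ j                   ∎
  where
  open ≡-Reasoning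
  u = incomparableCount true true j
  v = incomparableCount true false j
  w = incomparableCount false true j
  t = 3 ^ j
  regroup : ∀ u v w t → u + (v + (w + (u + 0))) + 2 * (3 * t) ≡ 2 * (u + 2 * t) + (v + t) + (w + t)
  regroup = solve-∀
  collect : ∀ x p → 2 * (x + p) + x + x ≡ 4 * x + 2 * p
  collect = solve-∀

10*3^j<4^j : ∀ {j} → 9 ≤ j → 10 * 3 ^ j < 4 ^ j
10*3^j<4^j 9≤j with k , refl ← m≤n⇒∃[o]m+o≡n 9≤j = begin-strict
  10 * 3 ^ (9 + k)     ≡⟨ cong (10 *_) (^-distribˡ-+-* 3 9 k) ⟩
  10 * (3 ^ 9 * 3 ^ k) ≡⟨ *-assoc 10 (3 ^ 9) (3 ^ k) ⟨
  10 * 3 ^ 9 * 3 ^ k   <⟨ *-monoˡ-< (3 ^ k) {{m^n≢0 3 k}} (≤ᵇ⇒≤ (suc (10 * 3 ^ 9)) (4 ^ 9) _) ⟩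
  4 ^ 9 * 3 ^ k        ≤⟨ *-monoʳ-≤ (4 ^ 9) (^-monoˡ-≤ k (≤ᵇ⇒≤ 3 4 _)) ⟩
  4 ^ 9 * 4 ^ k        ≡⟨ ^-distribˡ-+-* 4 9 k ⟨
  4 ^ (9 + k)          ∎
  where open ≤-Reasoning

-- Each classCount below unfolds definitionally into a sum of incomparableCount values, spelled
-- out in the last line of the corresponding chain.
module _ {j : ℕ} (j≥9 : 9 ≤ j) where

  private
    X = 4 ^ j
    T = 3 ^ j
    P = 2 ^ j
    u = incomparableCount true true j
    v = incomparableCount true false j
    w = incomparableCount false true j

    margin : ∀ {c} → c ≤ 10 → c * T < X
    margin c≤10 = ≤-<-trans (*-monoˡ-≤ T c≤10) (10*3^j<4^j j≥9)

  yes-class-large₀ : 4 ^ j < 2 * classCount true allHold j 0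
  yes-class-large₀ = <-by-margin (margin {4} (≤ᵇ⇒≤ 4 10 _)) (begin
    X + X                ≤⟨ m≤m+n (X + X) (2 * P) ⟩
    X + X + 2 * P        ≡⟨ regroup X P ⟩
    2 * (X + P)          ≡⟨ cong (2 *_) (incomparableCount-tt j) ⟨
    2 * (u + 2 * T)      ≡⟨ expand u T ⟩
    2 * u + 4 * T        ∎)
    where
    open ≤-Reasoning
    regroup : ∀ x p → x + x + 2 * p ≡ 2 * (x + p)
    regroup = solve-∀
    expand : ∀ u t → 2 * (u + 2 * t) ≡ 2 * u + 4 * t
    expand = solve-∀

  yes-class-large₁ : 4 ^ suc j < 2 * classCount true allHold j 1
  yes-class-large₁ = <-by-margin (margin {8} (≤ᵇ⇒≤ 8 10 _)) (begin
    4 * X + X                                   ≤⟨ m≤m+n (4 * X + X) (X + 2 * P) ⟩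
    4 * X + X + (X + 2 * P)                     ≡⟨ regroup X P ⟩
    2 * (X + P) + 2 * X + 2 * X                 ≡⟨ cong₂ _+_ (cong₂ _+_ (cong (2 *_) (incomparableCount-tt j))
                                                                        (cong (2 *_) (incomparableCount-tf j)))
                                                             (cong (2 *_) (incomparableCount-ft j)) ⟨
    2 * (u + 2 * T) + 2 * (v + T) + 2 * (w + T) ≡⟨ expand u v w T ⟩
    2 * (u + (v + (w + 0))) + 8 * T             ∎)
    where
    open ≤-Reasoning
    regroup : ∀ x p → 4 * x + x + (x + 2 * p) ≡ 2 * (x + p) + 2 * x + 2 * x
    regroup = solve-∀
    expand : ∀ u v w t → 2 * (u + 2 * t) + 2 * (v + t) + 2 * (w + t) ≡ 2 * (u + (v + (w + 0))) + 8 * t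
    expand = solve-∀

  no-class-large₂ : 4 ^ (2 + j) < 2 * classCount false allHold j 2
  no-class-large₂ rewrite incomparableCount-ff j = <-by-margin (*-monoʳ-< 2 (margin {10} ≤-refl)) (begin
    4 * (4 * X) + 2 * X                                 ≤⟨ m≤m+n (4 * (4 * X) + 2 * X) (6 * P) ⟩
    4 * (4 * X) + 2 * X + 6 * P                         ≡⟨ regroup X P ⟩
    6 * (X + P) + 4 * X + 4 * X + 4 * X                 ≡⟨ cong₂ _+_ (cong₂ _+_ (cong₂ _+_
                                                             (cong (6 *_) (incomparableCount-tt j))
                                                             (cong (4 *_) (incomparableCount-tf j)))
                                                             (cong (4 *_) (incomparableCount-ft j))) refl ⟨
    6 * (u + 2 * T) + 4 * (v + T) + 4 * (w + T) + 4 * X ≡⟨ expand u v w X T ⟩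
    2 * ((u + 0) + ((X + (v + 0)) + ((X + (w + 0)) + ((u + (v + (w + (u + 0)))) + 0)))) + 2 * (10 * T) ∎)
    where
    open ≤-Reasoning
    regroup : ∀ x p → 4 * (4 * x) + 2 * x + 6 * p ≡ 6 * (x + p) + 4 * x + 4 * x + 4 * x
    regroup = solve-∀
    expand : ∀ u v w x t → 6 * (u + 2 * t) + 4 * (v + t) + 4 * (w + t) + 4 * x ≡
             2 * ((u + 0) + ((x + (v + 0)) + ((x + (w + 0)) + ((u + (v + (w + (u + 0)))) + 0)))) + 2 * (10 * t)
    expand = solve-∀

keepZeros : ℕ → Subset n → Subset n
keepZeros k       []          = []
keepZeros k       (true  ∷ Q) = true ∷ keepZeros k Q
keepZeros zero    (false ∷ Q) = true ∷ keepZeros zero Q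
keepZeros (suc k) (false ∷ Q) = false ∷ keepZeros k Q

⊆-keepZeros : ∀ k (Q : Subset n) → Q ⊆ keepZeros k Q
⊆-keepZeros k       []          = λ ()
⊆-keepZeros k       (true  ∷ Q) = s⊆s (⊆-keepZeros k Q)
⊆-keepZeros zero    (false ∷ Q) = out⊆ (⊆-keepZeros zero Q)
⊆-keepZeros (suc k) (false ∷ Q) = s⊆s (⊆-keepZeros k Q)

∣∁keepZeros∣ : ∀ k (Q : Subset n) → k ≤ ∣ ∁ Q ∣ → ∣ ∁ (keepZeros k Q) ∣ ≡ k
∣∁keepZeros∣ zero    []          _   = refl
∣∁keepZeros∣ k       (true  ∷ Q) k≤ = ∣∁keepZeros∣ k Q k≤
∣∁keepZeros∣ zero    (false ∷ Q) _   = ∣∁keepZeros∣ zero Q z≤n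
∣∁keepZeros∣ (suc k) (false ∷ Q) k≤ = cong suc (∣∁keepZeros∣ k Q (s≤s⁻¹ k≤))

answerClass : Bool → Subset n → List (Pair n)
answerClass a Q = pairsWhere (classify a Q allHold)

answerClass-members : ∀ a (Q : Subset n) →
                      All (λ p → Incomparable p × answer (pairFamily p) Q ≡ a) (answerClass a Q)
answerClass-members a Q = All.tabulate (classify-sound a Q ∘ ∈-pairsWhere⁻)

size-split : ∀ (Q : Subset n) {z j} → ∣ ∁ Q ∣ ≡ z → ∣ Q ∣ ≡ j → z + j ≡ n
size-split Q refl refl = ∣∁p∣+∣p∣≡n Q

answerClass-large : ∀ a (Q : Subset n) {j z} → ∣ ∁ Q ∣ ≡ z → ∣ Q ∣ ≡ j →
                    4 ^ (z + j) < 2 * classCount a allHold j z → 4 ^ n < 2 * length (answerClass a Q)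
answerClass-large a Q refl refl large =
  subst₂ (λ m ℓ → 4 ^ m < 2 * ℓ) (∣∁p∣+∣p∣≡n Q) (sym (length-classify a Q allHold)) large

LargeClass : Subset n → Set
LargeClass {n} Q = Σ Bool λ a → Σ (List (Pair n)) λ L →
  Unique L × All (λ p → Incomparable p × answer (pairFamily p) Q ≡ a) L × 4 ^ n < 2 * length L

yes-class : ∀ (Q : Subset n) → 4 ^ n < 2 * length (answerClass true Q) → LargeClass Q
yes-class Q large = true , answerClass true Q , pairsWhere-unique _ , answerClass-members true Q , large

enough-inside : ∀ {n z j} → 11 ≤ n → z ≤ 2 → z + j ≡ n → 9 ≤ j
enough-inside {z = z} {j} n≥11 z≤2 refl = +-cancelˡ-≤ 2 9 j (≤-trans n≥11 (+-monoˡ-≤ j z≤2))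

large-answer-class : 11 ≤ n → (Q : Subset n) → LargeClass Q
large-answer-class {n} n≥11 Q with ∣ ∁ Q ∣ in outside | ∣ Q ∣ in inside
... | 0 | _ = yes-class Q (answerClass-large true Q outside inside
                (yes-class-large₀ (enough-inside n≥11 z≤n (size-split Q outside inside))))
... | 1 | _ = yes-class Q (answerClass-large true Q outside inside
                (yes-class-large₁ (enough-inside n≥11 (s≤s z≤n) (size-split Q outside inside))))
... | suc (suc _) | _ =
  false , answerClass false Q′ , pairsWhere-unique _ , answers-false ,
  answerClass-large false Q′ outside′ refl (no-class-large₂ (enough-inside n≥11 ≤-refl (size-split Q′ outside′ refl)))
  where
  Q′ = keepZeros 2 Q
  outside′ : ∣ ∁ Q′ ∣ ≡ 2
  outside′ = ∣∁keepZeros∣ 2 Q (subst (2 ≤_) (sym outside) (s≤s (s≤s z≤n)))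
  answers-false : All (λ p → Incomparable p × answer (pairFamily p) Q ≡ false) (answerClass false Q′)
  answers-false = All.map (λ {p} → map₂ (answer-mono-false (pairFamily p) (⊆-keepZeros 2 Q))) (answerClass-members false Q′)

lower-bound : ∀ {n q} → 11 ≤ n → Achievable n 2 q → 2 * n ≤ q
lower-bound {n} {q} n≥11 (T , determines , worst) with large-answer-class n≥11 (firstQuery T)
... | _ , L , unique , members , large =
  query-count-bound (≤-trans (s≤s z≤n) n≥11) large
    (fixed-first-answer-bound T q unique (All.map proj₂ members) (determines⇒separates {T = T} determines incomparable)
                              depth)
  where
  incomparable : All Incomparable L
  incomparable = All.map proj₁ members
  depth : Depth≤ T q L
  depth = All.tabulate (λ p∈L → worst _ (incomparable⇒antichain (All.lookup incomparable p∈L)))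

proposition1p6 : (n : ℕ) → 12 ≤ n → IsF n 2 (2 * n)
proposition1p6 n n≥12 = upper-bound , λ q → lower-bound (≤-trans (n≤1+n 11) n≥12)
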